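{- Let $G$ be a connected graph and let $D_G$ be its canonical split decomposition. If $v\in V(G)$ is the centre of a bag of $D_G$ that is a star, then $v$ is a cut-vertex of $G$.
   Context: All graphs are finite and simple. For $Z\subseteq V(G)$, $N_G(Z)$ is the set of vertices outside $Z$ having a neighbour in $Z$. A split of a connected graph $G$ is a partition $(X,Y)$ of $V(G)$ with $|X|,|Y|\ge 2$ such that every vertex of $N_G(X)$ is adjacent to every vertex of $N_G(Y)$; a connected graph with no split is prime. A marked graph is a connected graph $D$ together with a set $M(D)\subseteq E(D)$ of marked edges that forms a matching, each marked edge being a cut-edge of $D$; endpoints of marked edges are marked vertices, the others are unmarked, and the connected components of $(V(D),E(D)\setminus M(D))$ are the bags of $D$. If $(X,Y)$ is a split of $G$, the simple decomposition of $G$ along $(X,Y)$ is the marked graph with vertex set $V(G)\cup\{x',y'\}$ ($x',y'$ new) and edge set $E(G[X])\cup E(G[Y])\cup\{x'y'\}\cup\{x'x: x\in X \text{ has a neighbour in } Y\}\cup\{y'y: y\in Y\text{ has a neighbour in }X\}$, with $x'y'$ marked. A split decomposition of $G$ is either $G$ or is obtained from a split decomposition $D'$ of $G$ by replacing a bag $H$ of $D'$ by a simple decomposition of $H$ (previously marked edges stay marked). A canonical split decomposition of $G$ is a split decomposition each of whose bags is a prime graph, a star $K_{1,n}$, or a complete graph, and which is not a refinement of another split decomposition with this property; it exists and is unique up to isomorphism, and is denoted $D_G$. The unmarked vertices of $D_G$ are the vertices of $G$. The centre of a star bag is its vertex of maximum degree. -}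

module Defs where

open import Level using (0ℓ)
open import Data.Nat using (ℕ; zero; suc)
open import Data.Fin using (Fin; zero; suc)
open import Data.Bool using (Bool; true; false)
open import Data.Empty using (⊥)
open import Data.Unit using (⊤)
open import Data.Product using (Σ; ∃; ∃-syntax; _×_; _,_)
open import Data.Sum using (_⊎_)
open import Relation.Nullary using (¬_)
open import Relation.Binary.PropositionalEquality using (_≡_; _≢_)
open import Relation.Binary.Construct.Closure.ReflexiveTransitive using (Star)
open import Function.Bundles using (_⇔_)

record Graph (n : ℕ) : Set₁ where
  field
    Adj    : Fin n → Fin n → Set
    sym    : ∀ {u v} → Adj u v → Adj v u
    irrefl : ∀ {u} → ¬ Adj u u
open Graph public

Connected : ∀ {n} → Graph n → Set
Connected G = ∀ u w → Star (Adj G) u w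

AdjAvoid : ∀ {n} → Graph n → Fin n → Fin n → Fin n → Set
AdjAvoid G v a b = Adj G a b × a ≢ v × b ≢ v

CutVertex : ∀ {n} → Graph n → Fin n → Set
CutVertex G v = ∃[ u ] ∃[ w ] (u ≢ v × w ≢ v × ¬ Star (AdjAvoid G v) u w)

record MGraph (m : ℕ) : Set₁ where
  field
    MAdj : Fin m → Fin m → Set
    Mk   : Fin m → Fin m → Set
open MGraph public

AdjU : ∀ {m} → MGraph m → Fin m → Fin m → Set
AdjU D u v = MAdj D u v × ¬ Mk D u v

-- u lies in the bag of D containing r (component of D minus marked edges)
InBag : ∀ {m} → MGraph m → Fin m → Fin m → Set
InBag D r u = Star (AdjU D) r u

TwoIn : ∀ {m} → (Fin m → Set) → Set
TwoIn P = ∃[ a ] ∃[ b ] (a ≢ b × P a × P b)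

module _ {m : ℕ} (D : MGraph m) (r : Fin m) (side : Fin m → Bool) where
  InX : Fin m → Set
  InX u = InBag D r u × side u ≡ true
  InY : Fin m → Set
  InY u = InBag D r u × side u ≡ false
  NbX : Fin m → Set
  NbX u = InY u × ∃[ x ] (InX x × AdjU D u x)
  NbY : Fin m → Set
  NbY u = InX u × ∃[ y ] (InY y × AdjU D u y)

  IsSplit : Set
  IsSplit = TwoIn InX × TwoIn InY × (∀ a b → NbX a → NbY b → AdjU D a b)

  -- replace the bag H by the simple decomposition of H along (X , Y);
  -- new vertices: zero = x' , suc zero = y' ; old vertex u becomes suc (suc u)
  replace : MGraph (suc (suc m))
  replace = record { MAdj = A ; Mk = K }
    where
    A : Fin (suc (suc m)) → Fin (suc (suc m)) → Set
    A zero zero = ⊥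
    A zero (suc zero) = ⊤
    A zero (suc (suc u)) = NbY u
    A (suc zero) zero = ⊤
    A (suc zero) (suc zero) = ⊥
    A (suc zero) (suc (suc u)) = NbX u
    A (suc (suc u)) zero = NbY u
    A (suc (suc u)) (suc zero) = NbX u
    A (suc (suc u)) (suc (suc w)) =
      MAdj D u w × (InBag D r u → InBag D r w → side u ≡ side w)
    K : Fin (suc (suc m)) → Fin (suc (suc m)) → Set
    K zero (suc zero) = ⊤
    K (suc zero) zero = ⊤
    K (suc (suc u)) (suc (suc w)) = Mk D u w
    K _ _ = ⊥

-- (D' , e') is obtained from (D , e) by a sequence of bag replacements;
-- e embeds V(G) onto the unmarked vertices.
data Refines {n : ℕ} : ∀ {m m'} → MGraph m → (Fin n → Fin m)
                      → MGraph m' → (Fin n → Fin m') → Set₁ where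
  done : ∀ {m} {D : MGraph m} {e} → Refines D e D e
  step : ∀ {m m'} {D : MGraph m} {e} {D' : MGraph m'} {e'} (r : Fin m) (side : Fin m → Bool)
       → IsSplit D r side
       → Refines (replace D r side) (λ i → suc (suc (e i))) D' e'
       → Refines D e D' e'

StrictRefines : ∀ {n m m'} → MGraph m → (Fin n → Fin m)
              → MGraph m' → (Fin n → Fin m') → Set₁
StrictRefines D e D' e' =
  Σ _ λ r → Σ _ λ side → IsSplit D r side × Refines (replace D r side) (λ i → suc (suc (e i))) D' e'

toMG : ∀ {n} → Graph n → MGraph n
toMG G = record { MAdj = Adj G ; Mk = λ _ _ → ⊥ }

SplitDecomp : ∀ {n m} → Graph n → MGraph m → (Fin n → Fin m) → Set₁
SplitDecomp G D e = Refines (toMG G) (λ i → i) D e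

Prime : ∀ {m} → MGraph m → Fin m → Set
Prime D r = ∀ side → ¬ IsSplit D r side

Complete : ∀ {m} → MGraph m → Fin m → Set
Complete D r = ∀ u w → InBag D r u → InBag D r w → u ≢ w → AdjU D u w

StarCentre : ∀ {m} → MGraph m → Fin m → Fin m → Set
StarCentre D r c =
  InBag D r c
  × (∀ u → InBag D r u → u ≢ c → AdjU D c u)
  × (∀ u w → InBag D r u → InBag D r w → u ≢ c → w ≢ c → ¬ AdjU D u w)
  × TwoIn (λ u → InBag D r u × u ≢ c)

IsStar : ∀ {m} → MGraph m → Fin m → Set
IsStar D r = ∃[ c ] StarCentre D r c

AllGood : ∀ {m} → MGraph m → Set
AllGood D = ∀ r → Prime D r ⊎ IsStar D r ⊎ Complete D r

record Iso {n m m'} (D : MGraph m) (e : Fin n → Fin m)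
           (D' : MGraph m') (e' : Fin n → Fin m') : Set where
  field
    to      : Fin m → Fin m'
    from    : Fin m' → Fin m
    from-to : ∀ u → from (to u) ≡ u
    to-from : ∀ u → to (from u) ≡ u
    adj     : ∀ u w → MAdj D u w ⇔ MAdj D' (to u) (to w)
    mk      : ∀ u w → Mk D u w ⇔ Mk D' (to u) (to w)
    emb     : ∀ i → to (e i) ≡ e' i

Canonical : ∀ {n m} → Graph n → MGraph m → (Fin n → Fin m) → Set₁
Canonical {n} G D e =
  SplitDecomp G D e × AllGood D
  × ¬ (Σ ℕ λ m' → Σ (MGraph m') λ D' → Σ (Fin n → Fin m') λ e' →
       Σ ℕ λ m'' → Σ (MGraph m'') λ D'' → Σ (Fin n → Fin m'') λ e'' →
       SplitDecomp G D' e' × AllGood D' × StrictRefines D' e' D'' e'' × Iso D'' e'' D e)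

-- Each bag B admits a retraction of D onto B that collapses every component of
-- D − B onto the marked vertex of B attaching it, keeps the edges of B, and maps
-- V(G) onto B; and each edge xy of G is realised in D by a walk from x to y whose
-- inner vertices are marked. Both properties survive the replacement of a bag by
-- a simple decomposition, so they hold for D_G. Now let v be the centre of a star
-- bag B. A walk of G − v is realised by a walk of D avoiding v, and along it the
-- retraction onto B cannot move away from a leaf, since the only edges of B at a
-- leaf go to the centre. As at least two leaves are images of vertices of G,
-- those vertices lie in different components of G − v.
module Submission where

open import Defs
open import Data.Nat using (ℕ; suc)
open import Data.Fin using (Fin; zero; suc)
open import Data.Fin.Properties using (suc-injective) renaming (_≟_ to _≟ᶠ_)
open import Data.Bool using (Bool; true; false; not)
open import Data.Bool.Properties using (not-¬; ¬-not) renaming (_≟_ to _≟ᵇ_)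
open import Data.Empty using (⊥; ⊥-elim)
open import Data.Unit using (tt)
open import Data.Product using (∃-syntax; _×_; _,_; proj₁; proj₂)
open import Data.Sum using (_⊎_; inj₁; inj₂)
open import Relation.Nullary using (¬_; yes; no)
open import Relation.Binary.PropositionalEquality
  using (_≡_; _≢_; refl; cong; subst; trans) renaming (sym to ≡-sym)
open import Relation.Binary.Construct.Closure.ReflexiveTransitive
  using (Star; ε; _◅_; _◅◅_; reverse) renaming (map to Star-map)

Star-preserves : ∀ {A : Set} {R : A → A → Set} (P : A → Set)
               → (∀ {a b} → P a → R a b → P b)
               → ∀ {a b} → P a → Star R a b → P b
Star-preserves P keeps pa ε        = pa
Star-preserves P keeps pa (r ◅ rs) = Star-preserves P keeps (keeps pa r) rs

BagEdge : ∀ {m} → MGraph m → Fin m → Fin m → Fin m → Set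
BagEdge D r p q = InBag D r p × InBag D r q × AdjU D p q

-- Marked vertices are those outside the image of e.
data InnerMarkedWalk {n m : ℕ} (D : MGraph m) (e : Fin n → Fin m) : Fin m → Fin m → Set where
  edge : ∀ {s t} → MAdj D s t → InnerMarkedWalk D e s t
  via  : ∀ {s h t} → MAdj D s h → (∀ x → h ≢ e x) → InnerMarkedWalk D e h t
       → InnerMarkedWalk D e s t

module _ {n m} {D : MGraph m} {e : Fin n → Fin m} where

  _++⟨_⟩_ : ∀ {s h t} → InnerMarkedWalk D e s h → (∀ x → h ≢ e x)
          → InnerMarkedWalk D e h t → InnerMarkedWalk D e s t
  edge a         ++⟨ h-marked ⟩ w = via a h-marked w
  via a marked p ++⟨ h-marked ⟩ w = via a marked (p ++⟨ h-marked ⟩ w)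

record BagRetraction {n m : ℕ} (D : MGraph m) (e : Fin n → Fin m) (r : Fin m) : Set where
  field
    retract        : Fin m → Fin m
    retract-inBag  : ∀ u → InBag D r (retract u)
    retract-fixes  : ∀ u → InBag D r u → retract u ≡ u
    retract-edge   : ∀ p q → MAdj D p q → retract p ≡ retract q ⊎ BagEdge D r p q
    retract-onto   : ∀ u → InBag D r u → ∃[ x ] (retract (e x) ≡ u)

record Realises {n m : ℕ} (G : Graph n) (D : MGraph m) (e : Fin n → Fin m) : Set where
  field
    adj-sym       : ∀ {u w} → MAdj D u w → MAdj D w u
    mark-sym      : ∀ {u w} → Mk D u w → Mk D w u
    e-injective   : ∀ x y → e x ≡ e y → x ≡ y
    edge-realised : ∀ x y → Adj G x y → InnerMarkedWalk D e (e x) (e y)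
    retraction    : ∀ r → BagRetraction D e r

module Symmetric {m} (D : MGraph m)
                 (adj-sym : ∀ {u w} → MAdj D u w → MAdj D w u)
                 (mark-sym : ∀ {u w} → Mk D u w → Mk D w u) where

  AdjU-sym : ∀ {u w} → AdjU D u w → AdjU D w u
  AdjU-sym (a , unmarked) = adj-sym a , λ k → unmarked (mark-sym k)

  InBag-sym : ∀ {r u} → InBag D r u → InBag D u r
  InBag-sym = reverse AdjU-sym

  InBag-extend : ∀ {r u w} → InBag D r u → AdjU D u w → InBag D r w
  InBag-extend p a = p ◅◅ (a ◅ ε)

  retraction-of-same-bag : ∀ {n} {e : Fin n → Fin m} {r s}
                         → InBag D s r → BagRetraction D e r → BagRetraction D e s
  retraction-of-same-bag {s = s} s~r ρ = record
    { retract       = retract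
    ; retract-inBag = λ u → s~r ◅◅ retract-inBag u
    ; retract-fixes = λ u s~u → retract-fixes u (InBag-sym s~r ◅◅ s~u)
    ; retract-edge  = λ p q a → edge-in-s (retract-edge p q a)
    ; retract-onto  = λ u s~u → retract-onto u (InBag-sym s~r ◅◅ s~u)
    }
    where
    open BagRetraction ρ
    edge-in-s : ∀ {p q} → retract p ≡ retract q ⊎ BagEdge D _ p q
              → retract p ≡ retract q ⊎ BagEdge D s p q
    edge-in-s (inj₁ eq)              = inj₁ eq
    edge-in-s (inj₂ (p-in , q-in , a)) = inj₂ (s~r ◅◅ p-in , s~r ◅◅ q-in , a)

-- Replacing a bag by a simple decomposition

pattern x′ = zero
pattern y′ = suc zero
pattern old u = suc (suc u)

module Replacement {n m} {G : Graph n} {D : MGraph m} {e : Fin n → Fin m} (R : Realises G D e)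
                   (r₀ : Fin m) (side : Fin m → Bool) (split : IsSplit D r₀ side) where
  open Realises R
  open Symmetric D adj-sym mark-sym
  module R₀ = BagRetraction (retraction r₀)

  D' : MGraph (suc (suc m))
  D' = replace D r₀ side

  e' : Fin n → Fin (suc (suc m))
  e' i = old (e i)

  InH : Fin m → Set
  InH = InBag D r₀

  adj-sym' : ∀ {u w} → MAdj D' u w → MAdj D' w u
  adj-sym' {x′}    {x′}    ()
  adj-sym' {x′}    {y′}    a = tt
  adj-sym' {x′}    {old w} a = a
  adj-sym' {y′}    {x′}    a = tt
  adj-sym' {y′}    {y′}    ()
  adj-sym' {y′}    {old w} a = a
  adj-sym' {old u} {x′}    a = a
  adj-sym' {old u} {y′}    a = a
  adj-sym' {old u} {old w} (a , same-side) = adj-sym a , λ w-in u-in → ≡-sym (same-side u-in w-in)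

  mark-sym' : ∀ {u w} → Mk D' u w → Mk D' w u
  mark-sym' {x′}    {x′}    ()
  mark-sym' {x′}    {y′}    k = tt
  mark-sym' {x′}    {old w} ()
  mark-sym' {y′}    {x′}    k = tt
  mark-sym' {y′}    {y′}    ()
  mark-sym' {y′}    {old w} ()
  mark-sym' {old u} {x′}    ()
  mark-sym' {old u} {y′}    ()
  mark-sym' {old u} {old w} k = mark-sym k

  module S' = Symmetric D' (λ {u} {w} → adj-sym' {u} {w}) (λ {u} {w} → mark-sym' {u} {w})

  marker : Bool → Fin (suc (suc m))
  marker true  = x′
  marker false = y′

  opposite : ∀ b → ∃[ y ] (InH y × side y ≡ not b)
  opposite true  = let (y , _ , _ , (y-in , y-side) , _) = proj₁ (proj₂ split) in y , y-in , y-side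
  opposite false = let (x , _ , _ , (x-in , x-side) , _) = proj₁ split in x , x-in , x-side

  Boundary : Bool → Fin m → Set
  Boundary b u = (InH u × side u ≡ b) × ∃[ y ] ((InH y × side y ≡ not b) × AdjU D u y)

  boundary-adj-marker : ∀ b {u} → Boundary b u → AdjU D' (old u) (marker b)
  boundary-adj-marker true  bd = bd , λ ()
  boundary-adj-marker false bd = bd , λ ()

  InNewBag : Bool → Fin (suc (suc m)) → Set
  InNewBag b x′      = b ≡ true
  InNewBag b y′      = b ≡ false
  InNewBag b (old u) = InH u × side u ≡ b

  marker-in-new : ∀ b → InNewBag b (marker b)
  marker-in-new true  = refl
  marker-in-new false = refl

  new-bag-closed : ∀ b {u' w'} → InNewBag b u' → AdjU D' u' w' → InNewBag b w'
  new-bag-closed b {x′}    {x′}    _ (() , _)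
  new-bag-closed b {x′}    {y′}    _ (_ , unmarked) = ⊥-elim (unmarked tt)
  new-bag-closed b {x′}    {old w} b≡ (((w-in , w-side) , _) , _) = w-in , trans w-side (≡-sym b≡)
  new-bag-closed b {y′}    {x′}    _ (_ , unmarked) = ⊥-elim (unmarked tt)
  new-bag-closed b {y′}    {y′}    _ (() , _)
  new-bag-closed b {y′}    {old w} b≡ (((w-in , w-side) , _) , _) = w-in , trans w-side (≡-sym b≡)
  new-bag-closed b {old u} {x′}    (_ , u-side) (((_ , u-side') , _) , _) = trans (≡-sym u-side) u-side'
  new-bag-closed b {old u} {y′}    (_ , u-side) (((_ , u-side') , _) , _) = trans (≡-sym u-side) u-side'
  new-bag-closed b {old u} {old w} (u-in , u-side) ((a , same-side) , unmarked) =
    w-in , trans (≡-sym (same-side u-in w-in)) u-side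
    where w-in = InBag-extend u-in (a , unmarked)

  inBag⇒InNewBag : ∀ b {u'} → InBag D' (marker b) u' → InNewBag b u'
  inBag⇒InNewBag b = Star-preserves (InNewBag b) (new-bag-closed b) (marker-in-new b)

  -- Follow the walk inside side b until it first crosses to the other side;
  -- the vertex before the crossing is on the boundary, hence adjacent to the marker.
  walk-to-marker : ∀ b {u y} → InH u → side u ≡ b → Star (AdjU D) u y → side y ≡ not b
                 → Star (AdjU D') (old u) (marker b)
  walk-to-marker b _ u-side ε y-side = ⊥-elim (not-¬ u-side y-side)
  walk-to-marker b u-in u-side (_◅_ {j = s} a p) y-side with side s ≟ᵇ b
  ... | yes s-side = ((proj₁ a , λ _ _ → trans u-side (≡-sym s-side)) , proj₂ a)
                     ◅ walk-to-marker b (InBag-extend u-in a) s-side p y-side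
  ... | no  s-side =
    boundary-adj-marker b ((u-in , u-side) , s , ((InBag-extend u-in a , ¬-not s-side) , a)) ◅ ε

  InNewBag⇒inBag : ∀ b {u'} → InNewBag b u' → InBag D' (marker b) u'
  InNewBag⇒inBag true  {x′}    refl = ε
  InNewBag⇒inBag false {y′}    refl = ε
  InNewBag⇒inBag b     {old u} (u-in , u-side) =
    let (y , y-in , y-side) = opposite b
    in S'.InBag-sym (walk-to-marker b u-in u-side (InBag-sym u-in ◅◅ y-in) y-side)

  collapse : Bool → Fin m → Fin (suc (suc m))
  collapse b w with side w ≟ᵇ b
  ... | yes _ = old w
  ... | no  _ = marker b

  collapse-same : ∀ b w → side w ≡ b → collapse b w ≡ old w
  collapse-same b w w-side with side w ≟ᵇ b
  ... | yes _       = refl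
  ... | no  w-side' = ⊥-elim (w-side' w-side)

  collapse-other : ∀ b w → side w ≢ b → collapse b w ≡ marker b
  collapse-other b w w-side with side w ≟ᵇ b
  ... | yes w-side' = ⊥-elim (w-side w-side')
  ... | no  _       = refl

  collapse-in-new : ∀ b w → InH w → InNewBag b (collapse b w)
  collapse-in-new b w w-in with side w ≟ᵇ b
  ... | yes w-side = w-in , w-side
  ... | no  _      = marker-in-new b

  collapse-retract-other : ∀ b q → InH q → side q ≢ b → collapse b (R₀.retract q) ≡ marker b
  collapse-retract-other b q q-in q-side =
    trans (cong (collapse b) (R₀.retract-fixes q q-in)) (collapse-other b q q-side)

  -- Retract onto H, then collapse the other side of H onto the marker of side b.
  new-retract : Bool → Fin (suc (suc m)) → Fin (suc (suc m))
  new-retract b x′      = marker b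
  new-retract b y′      = marker b
  new-retract b (old u) = collapse b (R₀.retract u)

  new-retract-inNew : ∀ b u' → InNewBag b (new-retract b u')
  new-retract-inNew b x′      = marker-in-new b
  new-retract-inNew b y′      = marker-in-new b
  new-retract-inNew b (old u) = collapse-in-new b (R₀.retract u) (R₀.retract-inBag u)

  new-retract-fixes : ∀ b u' → InNewBag b u' → new-retract b u' ≡ u'
  new-retract-fixes true  x′      refl = refl
  new-retract-fixes false y′      refl = refl
  new-retract-fixes b     (old u) (u-in , u-side) =
    trans (cong (collapse b) (R₀.retract-fixes u u-in)) (collapse-same b u u-side)

  RespectsEdge : Bool → Fin (suc (suc m)) → Fin (suc (suc m)) → Set
  RespectsEdge b p q = new-retract b p ≡ new-retract b q ⊎ BagEdge D' (marker b) p q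

  RespectsEdge-swap : ∀ b {p q} → RespectsEdge b p q → RespectsEdge b q p
  RespectsEdge-swap b (inj₁ eq)                = inj₁ (≡-sym eq)
  RespectsEdge-swap b (inj₂ (p-in , q-in , a)) = inj₂ (q-in , p-in , S'.AdjU-sym a)

  marker-edge : ∀ b c q → MAdj D' (marker c) (old q) → RespectsEdge b (marker c) (old q)
  marker-edge true  true  q a = inj₂ (ε , InNewBag⇒inBag true (proj₁ a) , (a , λ ()))
  marker-edge false false q a = inj₂ (ε , InNewBag⇒inBag false (proj₁ a) , (a , λ ()))
  marker-edge true  false q ((q-in , q-side) , _) =
    inj₁ (≡-sym (collapse-retract-other true q q-in (λ q-side' → not-¬ q-side' q-side)))
  marker-edge false true  q ((q-in , q-side) , _) =
    inj₁ (≡-sym (collapse-retract-other false q q-in (λ q-side' → not-¬ q-side' q-side)))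

  new-retract-edge : ∀ b p' q' → MAdj D' p' q' → RespectsEdge b p' q'
  new-retract-edge b x′      x′      ()
  new-retract-edge b x′      y′      _ = inj₁ refl
  new-retract-edge b y′      x′      _ = inj₁ refl
  new-retract-edge b y′      y′      ()
  new-retract-edge b x′      (old q) a = marker-edge b true q a
  new-retract-edge b y′      (old q) a = marker-edge b false q a
  new-retract-edge b (old p) x′      a = RespectsEdge-swap b (marker-edge b true p a)
  new-retract-edge b (old p) y′      a = RespectsEdge-swap b (marker-edge b false p a)
  new-retract-edge b (old p) (old q) (a , same-side) with R₀.retract-edge p q a
  ... | inj₁ eq = inj₁ (cong (collapse b) eq)
  ... | inj₂ (p-in , q-in , (_ , unmarked)) with side p ≟ᵇ b
  ...   | yes p-side = inj₂ ( InNewBag⇒inBag b (p-in , p-side)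
                            , InNewBag⇒inBag b (q-in , trans (≡-sym (same-side p-in q-in)) p-side)
                            , ((a , same-side) , unmarked))
  ...   | no  p-side = inj₁ (trans (collapse-retract-other b p p-in p-side)
                                   (≡-sym (collapse-retract-other b q q-in
                                             (λ q-side → p-side (trans (same-side p-in q-in) q-side)))))

  marker-onto : ∀ b → ∃[ x ] (new-retract b (e' x) ≡ marker b)
  marker-onto b = let (y , y-in , y-side) = opposite b
                      (x , x↦y) = R₀.retract-onto y y-in
                  in x , trans (cong (collapse b) x↦y) (collapse-other b y (λ y-side' → not-¬ y-side' y-side))

  new-retract-onto : ∀ b u' → InNewBag b u' → ∃[ x ] (new-retract b (e' x) ≡ u')
  new-retract-onto true  x′      refl = marker-onto true
  new-retract-onto false y′      refl = marker-onto false
  new-retract-onto b     (old u) (u-in , u-side) =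
    let (x , x↦u) = R₀.retract-onto u u-in
    in x , trans (cong (collapse b) x↦u) (collapse-same b u u-side)

  new-retraction : ∀ b → BagRetraction D' e' (marker b)
  new-retraction b = record
    { retract       = new-retract b
    ; retract-inBag = λ u' → InNewBag⇒inBag b (new-retract-inNew b u')
    ; retract-fixes = λ u' u'-in → new-retract-fixes b u' (inBag⇒InNewBag b u'-in)
    ; retract-edge  = new-retract-edge b
    ; retract-onto  = λ u' u'-in → new-retract-onto b u' (inBag⇒InNewBag b u'-in)
    }

  -- A bag of D other than H is a bag of D', whose marked vertex attaching the
  -- split bag now attaches both new bags.
  module Unsplit (r : Fin m) (r∉H : ¬ InH r) where
    module Rr = BagRetraction (retraction r)

    outside-H : ∀ {u} → InBag D r u → ¬ InH u
    outside-H r~u u-in = r∉H (u-in ◅◅ InBag-sym r~u)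

    retract-constant-on-H : ∀ {u} → InH u → Rr.retract u ≡ Rr.retract r₀
    retract-constant-on-H u-in = proj₂ (Star-preserves Retracts-like-r₀ keeps (ε , refl) u-in)
      where
      Retracts-like-r₀ : Fin m → Set
      Retracts-like-r₀ u = InH u × Rr.retract u ≡ Rr.retract r₀
      keeps : ∀ {u w} → Retracts-like-r₀ u → AdjU D u w → Retracts-like-r₀ w
      keeps {u} {w} (u-in , u↦) (a , unmarked) with Rr.retract-edge u w a
      ... | inj₁ eq             = InBag-extend u-in (a , unmarked) , trans (≡-sym eq) u↦
      ... | inj₂ (r~u , _ , _) = ⊥-elim (outside-H r~u u-in)

    lift-walk : ∀ {a u} → InBag D r a → Star (AdjU D) a u → Star (AdjU D') (old a) (old u)
    lift-walk r~a ε = ε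
    lift-walk r~a ((a , unmarked) ◅ p) =
      ((a , λ a-in _ → ⊥-elim (outside-H r~a a-in)) , unmarked)
      ◅ lift-walk (InBag-extend r~a (a , unmarked)) p

    lift-bag : ∀ {u} → InBag D r u → InBag D' (old r) (old u)
    lift-bag = lift-walk ε

    InOldBag : Fin (suc (suc m)) → Set
    InOldBag x′      = ⊥
    InOldBag y′      = ⊥
    InOldBag (old u) = InBag D r u

    old-bag-closed : ∀ {u' w'} → InOldBag u' → AdjU D' u' w' → InOldBag w'
    old-bag-closed {old u} {x′}    r~u (((u-in , _) , _) , _) = outside-H r~u u-in
    old-bag-closed {old u} {y′}    r~u (((u-in , _) , _) , _) = outside-H r~u u-in
    old-bag-closed {old u} {old w} r~u ((a , _) , unmarked)   = InBag-extend r~u (a , unmarked)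

    inBag⇒InOldBag : ∀ {u'} → InBag D' (old r) u' → InOldBag u'
    inBag⇒InOldBag = Star-preserves InOldBag (λ {u'} {w'} → old-bag-closed {u'} {w'}) ε

    old-retract : Fin (suc (suc m)) → Fin (suc (suc m))
    old-retract x′      = old (Rr.retract r₀)
    old-retract y′      = old (Rr.retract r₀)
    old-retract (old u) = old (Rr.retract u)

    old-retract-inBag : ∀ u' → InBag D' (old r) (old-retract u')
    old-retract-inBag x′      = lift-bag (Rr.retract-inBag r₀)
    old-retract-inBag y′      = lift-bag (Rr.retract-inBag r₀)
    old-retract-inBag (old u) = lift-bag (Rr.retract-inBag u)

    old-retract-fixes : ∀ u' → InOldBag u' → old-retract u' ≡ u'
    old-retract-fixes (old u) r~u = cong old (Rr.retract-fixes u r~u)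

    old-retract-edge : ∀ p' q' → MAdj D' p' q'
                     → old-retract p' ≡ old-retract q' ⊎ BagEdge D' (old r) p' q'
    old-retract-edge x′      x′      ()
    old-retract-edge x′      y′      _ = inj₁ refl
    old-retract-edge y′      x′      _ = inj₁ refl
    old-retract-edge y′      y′      ()
    old-retract-edge x′      (old q) ((q-in , _) , _) = inj₁ (cong old (≡-sym (retract-constant-on-H q-in)))
    old-retract-edge y′      (old q) ((q-in , _) , _) = inj₁ (cong old (≡-sym (retract-constant-on-H q-in)))
    old-retract-edge (old p) x′      ((p-in , _) , _) = inj₁ (cong old (retract-constant-on-H p-in))
    old-retract-edge (old p) y′      ((p-in , _) , _) = inj₁ (cong old (retract-constant-on-H p-in))
    old-retract-edge (old p) (old q) (a , same-side) with Rr.retract-edge p q a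
    ... | inj₁ eq                            = inj₁ (cong old eq)
    ... | inj₂ (r~p , r~q , (_ , unmarked)) = inj₂ (lift-bag r~p , lift-bag r~q , ((a , same-side) , unmarked))

    old-retract-onto : ∀ u' → InOldBag u' → ∃[ x ] (old-retract (e' x) ≡ u')
    old-retract-onto (old u) r~u = let (x , x↦u) = Rr.retract-onto u r~u in x , cong old x↦u

    old-retraction : BagRetraction D' e' (old r)
    old-retraction = record
      { retract       = old-retract
      ; retract-inBag = old-retract-inBag
      ; retract-fixes = λ u' r~u' → old-retract-fixes u' (inBag⇒InOldBag r~u')
      ; retract-edge  = old-retract-edge
      ; retract-onto  = λ u' r~u' → old-retract-onto u' (inBag⇒InOldBag r~u')
      }

  retraction' : ∀ r' → BagRetraction D' e' r'
  retraction' x′ = new-retraction true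
  retraction' y′ = new-retraction false
  retraction' (old r) with R₀.retract r ≟ᶠ r
  ... | no  r∉H = Unsplit.old-retraction r (λ r-in → r∉H (R₀.retract-fixes r r-in))
  ... | yes r↦r =
    let r-in = subst InH r↦r (R₀.retract-inBag r)
        (y , y-in , y-side) = opposite (side r)
    in S'.retraction-of-same-bag (walk-to-marker (side r) r-in refl (InBag-sym r-in ◅◅ y-in) y-side)
                                 (new-retraction (side r))

  -- A crossing edge pq of H is realised by the walk p x′ y′ q or p y′ x′ q.
  H-edge-realised : ∀ {p q} → MAdj D p q → InH p → InH q → AdjU D p q
                  → ∀ bp bq → side p ≡ bp → side q ≡ bq → InnerMarkedWalk D' e' (old p) (old q)
  H-edge-realised a _ _ _ true  true  p-side q-side = edge (a , λ _ _ → trans p-side (≡-sym q-side))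
  H-edge-realised a _ _ _ false false p-side q-side = edge (a , λ _ _ → trans p-side (≡-sym q-side))
  H-edge-realised {p} {q} a p-in q-in au true false p-side q-side =
    via {h = x′} ((p-in , p-side) , q , ((q-in , q-side) , au)) (λ _ ())
      (via {h = y′} tt (λ _ ()) (edge ((q-in , q-side) , p , ((p-in , p-side) , AdjU-sym au))))
  H-edge-realised {p} {q} a p-in q-in au false true p-side q-side =
    via {h = y′} ((p-in , p-side) , q , ((q-in , q-side) , au)) (λ _ ())
      (via {h = x′} tt (λ _ ()) (edge ((q-in , q-side) , p , ((p-in , p-side) , AdjU-sym au))))

  -- An edge of D collapsed by the retraction onto H joins no two distinct
  -- vertices of H, so it is an edge of D'.
  edge-realised' : ∀ {p q} → MAdj D p q → InnerMarkedWalk D' e' (old p) (old q)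
  edge-realised' {p} {q} a with R₀.retract-edge p q a
  ... | inj₁ eq = edge (a , λ p-in q-in → cong side (trans (≡-sym (R₀.retract-fixes p p-in))
                                                            (trans eq (R₀.retract-fixes q q-in))))
  ... | inj₂ (p-in , q-in , au) = H-edge-realised a p-in q-in au (side p) (side q) refl refl

  walk-realised' : ∀ {s t} → InnerMarkedWalk D e s t → InnerMarkedWalk D' e' (old s) (old t)
  walk-realised' (edge a)             = edge-realised' a
  walk-realised' (via a h-marked rest) =
    edge-realised' a ++⟨ (λ x eq → h-marked x (suc-injective (suc-injective eq))) ⟩ walk-realised' rest

  realises' : Realises G D' e'
  realises' = record
    { adj-sym       = λ {u} {w} → adj-sym' {u} {w}
    ; mark-sym      = λ {u} {w} → mark-sym' {u} {w}
    ; e-injective   = λ x y eq → e-injective x y (suc-injective (suc-injective eq))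
    ; edge-realised = λ x y a → walk-realised' (edge-realised x y a)
    ; retraction    = retraction'
    }

Refines-preserves-Realises : ∀ {n m m'} {G : Graph n} {D : MGraph m} {e} {D' : MGraph m'} {e'}
                           → Refines D e D' e' → Realises G D e → Realises G D' e'
Refines-preserves-Realises done                      R = R
Refines-preserves-Realises (step r side split rest) R =
  Refines-preserves-Realises rest (Replacement.realises' R r side split)

toMG-realises : ∀ {n} (G : Graph n) → Connected G → Realises G (toMG G) (λ i → i)
toMG-realises G connected = record
  { adj-sym       = Graph.sym G
  ; mark-sym      = λ ()
  ; e-injective   = λ _ _ eq → eq
  ; edge-realised = λ _ _ a → edge a
  ; retraction    = λ r → record
      { retract       = λ u → u
      ; retract-inBag = λ u → in-bag r u
      ; retract-fixes = λ _ _ → refl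
      ; retract-edge  = λ p q a → inj₂ (in-bag r p , in-bag r q , (a , λ ()))
      ; retract-onto  = λ u _ → u , refl
      }
  }
  where
  in-bag : ∀ r u → InBag (toMG G) r u
  in-bag r u = Star-map (λ a → a , λ ()) (connected r u)

module _ {n m} {G : Graph n} {D : MGraph m} {e : Fin n → Fin m} (R : Realises G D e) where
  open Realises R

  module _ {v r} (centre : StarCentre D r (e v)) where
    open BagRetraction (retraction r)

    -- Only the centre is adjacent to a leaf inside the bag, so a step of D
    -- avoiding the centre cannot move the retraction off a leaf.
    leaf-stays : ∀ {ℓ p q} → ℓ ≢ e v → MAdj D p q → q ≢ e v → retract p ≡ ℓ → retract q ≡ ℓ
    leaf-stays {ℓ} {p} {q} ℓ≢c a q≢c p↦ℓ with retract-edge p q a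
    ... | inj₁ eq                 = trans (≡-sym eq) p↦ℓ
    ... | inj₂ (p-in , q-in , au) =
      ⊥-elim (proj₁ (proj₂ (proj₂ centre)) p q p-in q-in
                    (λ p≡c → ℓ≢c (trans (≡-sym p↦ℓ) (trans (retract-fixes p p-in) p≡c)))
                    q≢c au)

    leaf-stays-inner-marked : ∀ {ℓ s t} → ℓ ≢ e v → InnerMarkedWalk D e s t → t ≢ e v
                            → retract s ≡ ℓ → retract t ≡ ℓ
    leaf-stays-inner-marked ℓ≢c (edge a)           t≢c = leaf-stays ℓ≢c a t≢c
    leaf-stays-inner-marked ℓ≢c (via a h-marked w) t≢c s↦ℓ =
      leaf-stays-inner-marked ℓ≢c w t≢c (leaf-stays ℓ≢c a (h-marked v) s↦ℓ)

    leaf-stays-avoiding : ∀ {ℓ x y} → ℓ ≢ e v → retract (e x) ≡ ℓ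
                        → Star (AdjAvoid G v) x y → retract (e y) ≡ ℓ
    leaf-stays-avoiding {ℓ} ℓ≢c = Star-preserves (λ x → retract (e x) ≡ ℓ) keeps
      where
      keeps : ∀ {x y} → retract (e x) ≡ ℓ → AdjAvoid G v x y → retract (e y) ≡ ℓ
      keeps {x} {y} x↦ℓ (a , _ , y≢v) =
        leaf-stays-inner-marked ℓ≢c (edge-realised x y a) (λ eq → y≢v (e-injective y v eq)) x↦ℓ

    leaf-preimage-≢ : ∀ {ℓ x} → ℓ ≢ e v → retract (e x) ≡ ℓ → x ≢ v
    leaf-preimage-≢ ℓ≢c x↦ℓ refl = ℓ≢c (trans (≡-sym x↦ℓ) (retract-fixes _ (proj₁ centre)))

    starCentre⇒cutVertex : CutVertex G v
    starCentre⇒cutVertex =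
      let (a , b , a≢b , (a-in , a≢c) , (b-in , b≢c)) = proj₂ (proj₂ (proj₂ centre))
          (x , x↦a) = retract-onto a a-in
          (y , y↦b) = retract-onto b b-in
      in x , y , leaf-preimage-≢ a≢c x↦a , leaf-preimage-≢ b≢c y↦b
         , λ walk → a≢b (trans (≡-sym (leaf-stays-avoiding a≢c x↦a walk)) y↦b)

lemma3 : ∀ {n m} (G : Graph n) → Connected G
         → (D : MGraph m) (e : Fin n → Fin m) → Canonical G D e
         → (v : Fin n) (r : Fin m) → StarCentre D r (e v)
         → CutVertex G v
lemma3 G connected D e (decomposition , _ , _) v r centre =
  starCentre⇒cutVertex (Refines-preserves-Realises decomposition (toMG-realises G connected)) centre
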